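{- Let $F \subseteq \mathbb{N}$ be a finite nonempty set with $\min F \geq 3$. Then $Q_{U(F,5)} > 1$.
   Context: For a nonzero integer $N$, $\mathrm{rad}(N)$ denotes the largest square-free positive divisor of $N$. For $a = (a_1,\ldots,a_n) \in \mathbb{Z}^n$ with all $a_i \neq 0$, the quality of $a$ is $q(a) = \frac{\log(\max\{|a_1|,\ldots,|a_n|\})}{\log \mathrm{rad}(a_1 \cdots a_n)}$. For a set $A$ of such $n$-tuples, $Q_A$ denotes the limit superior of $q(a)$ over $a \in A$ (i.e. $\inf_{S \subseteq A \text{ finite}} \sup_{a \in A \setminus S} q(a)$). For a finite set $F \subseteq \mathbb{N}$, $U(F,5)$ is the set of all $(a_1,\ldots,a_5) \in \mathbb{Z}^5$ such that: (i) $\gcd(a_i,a_j) = 1$ for all $1 \leq i < j \leq 5$; (ii) $a_1 + \cdots + a_5 = 0$; (iii) there are no $b_1,\ldots,b_5 \in \{ -1,0,1\}$ and indices $i,j$ with $b_i = 0$, $b_j = 1$ and $\sum_{k=1}^5 b_k a_k = 0$; (iv) none of $a_1,\ldots,a_5$ is a multiple of any element of $F$. -}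

module Defs where

open import Data.Nat as ℕ using (ℕ; zero; suc; _^_; _<_; _≤_)
open import Data.Nat.Divisibility using (_∣_; _∣?_)
open import Data.Nat.Primality using (Prime; prime?)
open import Data.Integer as ℤ using (ℤ; +_; -[1+_]; ∣_∣; 0ℤ; 1ℤ)
open import Data.Integer.GCD using (gcd)
open import Data.List using (List; filter; upTo; map)
open import Data.Nat.ListAction using (product)
open import Data.List.Membership.Propositional using (_∈_)
open import Data.Vec using (Vec; lookup; foldr)
open import Data.Fin using (Fin)
open import Data.Product using (_×_; ∃)
open import Relation.Nullary using (¬_)
open import Relation.Nullary.Decidable using (_×-dec_)
open import Relation.Binary.PropositionalEquality using (_≡_; _≢_)
import Relation.Binary.PropositionalEquality as Eq

rad : ℕ → ℕ
rad n = product (filter (λ p → prime? p ×-dec (p ∣? n)) (upTo (suc n)))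

Tuple5 : Set
Tuple5 = Vec ℤ 5

sumℤ : ∀ {n} → Vec ℤ n → ℤ
sumℤ = foldr _ ℤ._+_ 0ℤ

prodℤ : ∀ {n} → Vec ℤ n → ℤ
prodℤ = foldr _ ℤ._*_ 1ℤ

maxAbs : ∀ {n} → Vec ℤ n → ℕ
maxAbs = foldr _ (λ x m → ∣ x ∣ ℕ.⊔ m) 0

AllNonzero : ∀ {n} → Vec ℤ n → Set
AllNonzero {n} a = (i : Fin n) → ¬ (lookup a i ≡ 0ℤ)

IsSign : ℤ → Set
IsSign b = (b ≡ -[1+ 0 ]) Data.Sum.⊎ (b ≡ 0ℤ) Data.Sum.⊎ (b ≡ + 1)
  where import Data.Sum

dot : ∀ {n} → Vec ℤ n → Vec ℤ n → ℤ
dot b a = sumℤ (Data.Vec.zipWith ℤ._*_ b a)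
  where import Data.Vec

record InU (F : List ℕ) (a : Tuple5) : Set where
  field
    coprime  : (i j : Fin 5) → i ≢ j → gcd (lookup a i) (lookup a j) ≡ + 1
    sumZero  : sumℤ a ≡ 0ℤ
    noSubsum : (b : Tuple5) → ((k : Fin 5) → IsSign (lookup b k)) →
               ∃ (λ i → lookup b i ≡ 0ℤ) → ∃ (λ j → lookup b j ≡ + 1) →
               ¬ (dot b a ≡ 0ℤ)
    noMult   : (i : Fin 5) (f : ℕ) → f ∈ F → ¬ (f ∣ ∣ lookup a i ∣)

-- q(a) > 1 + r/s   (s > 0), written without logarithms:
--   log M / log R > (s + r)/s  ⟺  M^s > R^(s+r)   (valid since R = rad ≥ 2 > 1)
QualityAbove : ∀ {n} → Vec ℤ n → ℕ → ℕ → Set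
QualityAbove a r s = rad ∣ prodℤ a ∣ ^ (s ℕ.+ r) < maxAbs a ^ s

-- Let N = 8 ∏F, M = N (N + 1) (N − 1) and X = (M + 1)ᵐ for a large m, so that X ≡ 1 (mod M)
-- and every prime factor of X divides M + 1. For A = X² + X − 1 and B = X² − X − 1 one has
-- A³ + B³ + 2 = 2 X⁶, so a = (A³, B³, −2 X⁶, N + 1, 1 − N) sums to zero. Its radical divides
-- A B · 2 (M + 1) (N + 1) (N − 1) < X⁵ while max |aᵢ| ≥ 2 X⁶, hence q(a) > 6/5.
-- Pairwise coprimality comes from A ≡ 1, B ≡ −1, X ≡ 1 (mod M) and A ≡ B ≡ −1 (mod X).
-- Modulo N the entries are (1, −1, −2, 1, 1), so none is a multiple of an f ≥ 3 dividing N.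
-- For b ∈ {−1, 0, 1}⁵ one has b · a = r + N t + p (A³ − 1) + q (B³ + 1) with |r| ≤ 6 < N,
-- |t| ≤ 2 < N² − 1 and M ∣ A³ − 1, B³ + 1; so b · a = 0 forces r = t = 0, and a check of all
-- 3⁵ sign vectors containing a 0 and a 1 shows that then q ≠ 0 and p ∈ {q, −q, 0}, leaving
-- q (A³ + B³), q (B³ − A³ + 2) or q (B³ + 1), none of which vanishes.

module Submission where

open import Defs
open import Data.Nat using (ℕ; _≤_; _<_)
open import Data.List using (List; [])
open import Data.List.Relation.Unary.All using (All)
open import Data.List.Membership.Propositional using (_∈_)
open import Data.Product using (Σ; _×_; ∃)
open import Relation.Nullary using (¬_)
open import Relation.Binary.PropositionalEquality using (_≡_)

module Coprimality where

  open import Data.Nat.Base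
  open import Data.Nat.Properties using (+-comm; *-identityˡ)
  open import Data.Nat.Divisibility
  open import Data.Nat.Coprimality using (Coprime; sym; coprime-divisor; coprime⇒gcd≡1; 1-coprimeTo)
  open import Data.Nat.GCD using (gcd)
  open import Data.Nat.LCM using (lcm; lcm-least; gcd*lcm)
  open import Data.Fin.Base using (zero; suc)
  open import Data.Vec.Base using (Vec; lookup)
  open import Data.Vec.Relation.Unary.AllPairs using (AllPairs; _∷_)
  open import Data.Vec.Relation.Unary.All.Properties using (lookup⁺)
  open import Data.Product using (_,_)
  open import Function.Base using (_∘_)
  open import Relation.Binary.Definitions using (Symmetric)
  open import Relation.Nullary using (contradiction)
  open import Relation.Binary.PropositionalEquality using (_≢_; refl; subst; cong)
  import Relation.Binary.PropositionalEquality as ≡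
  open ≡.≡-Reasoning

  private variable a b c d m : ℕ

  coprime-≡1 : d ∣ m → Coprime (suc m) d
  coprime-≡1 {m = m} d∣m {e} (e∣1+m , e∣d) =
    ∣1⇒≡1 (∣m+n∣m⇒∣n (subst (e ∣_) (+-comm 1 m) e∣1+m) (∣-trans e∣d d∣m))

  coprime-≡-1 : d ∣ suc m → Coprime m d
  coprime-≡-1 {m = m} d∣1+m {e} (e∣m , e∣d) =
    ∣1⇒≡1 (∣m+n∣m⇒∣n (subst (e ∣_) (+-comm 1 m) (∣-trans e∣d d∣1+m)) e∣m)

  coprime-*ˡ : Coprime a c → Coprime b c → Coprime (a * b) c
  coprime-*ˡ {a} a⊥c b⊥c {d} (d∣ab , d∣c) = b⊥c (coprime-divisor d⊥a d∣ab , d∣c)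
    where
    d⊥a : Coprime d a
    d⊥a (e∣d , e∣a) = a⊥c (e∣a , ∣-trans e∣d d∣c)

  coprime-*ʳ : Coprime a b → Coprime a c → Coprime a (b * c)
  coprime-*ʳ a⊥b a⊥c = sym (coprime-*ˡ (sym a⊥b) (sym a⊥c))

  coprime-^ˡ : ∀ k → Coprime a c → Coprime (a ^ k) c
  coprime-^ˡ zero    _   = 1-coprimeTo _
  coprime-^ˡ (suc k) a⊥c = coprime-*ˡ a⊥c (coprime-^ˡ k a⊥c)

  coprime-^ʳ : ∀ k → Coprime a c → Coprime a (c ^ k)
  coprime-^ʳ k a⊥c = sym (coprime-^ˡ k (sym a⊥c))

  coprime-*∣ : Coprime a b → a ∣ d → b ∣ d → a * b ∣ d
  coprime-*∣ {a} {b} a⊥b a∣d b∣d = subst (_∣ _) lcm≡ab (lcm-least a∣d b∣d)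
    where
    lcm≡ab : lcm a b ≡ a * b
    lcm≡ab = begin
      lcm a b           ≡⟨ *-identityˡ (lcm a b) ⟨
      1 * lcm a b       ≡⟨ cong (_* lcm a b) (coprime⇒gcd≡1 a⊥b) ⟨
      gcd a b * lcm a b ≡⟨ gcd*lcm a b ⟩
      a * b             ∎

  allPairs-lookup : ∀ {A : Set} {R : A → A → Set} {k} {xs : Vec A k} → Symmetric R →
                    AllPairs R xs → ∀ {i j} → i ≢ j → R (lookup xs i) (lookup xs j)
  allPairs-lookup R-sym (Rx ∷ Rxs) {zero}  {zero}  i≢j = contradiction refl i≢j
  allPairs-lookup R-sym (Rx ∷ Rxs) {zero}  {suc j} _   = lookup⁺ Rx j
  allPairs-lookup R-sym (Rx ∷ Rxs) {suc i} {zero}  _   = R-sym (lookup⁺ Rx i)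
  allPairs-lookup R-sym (Rx ∷ Rxs) {suc i} {suc j} i≢j = allPairs-lookup R-sym Rxs (i≢j ∘ cong suc)

module Radical where

  open import Data.Nat.Base
  open import Data.Nat.Divisibility
  open import Data.Nat.Coprimality using (Coprime)
  open import Data.Nat.Primality
  open import Data.Nat.Primality.Factorisation using (factorisationHasAllPrimeFactors)
  open import Data.Nat.ListAction using (product)
  open import Data.Integer.Base as ℤ using (ℤ)
  open import Data.Integer.Properties using (abs-*)
  open import Data.List.Base using (_∷_; upTo)
  open import Data.List.Relation.Unary.All as All using ([]; _∷_)
  open import Data.List.Relation.Unary.All.Properties using (all-filter)
  open import Data.List.Relation.Unary.AllPairs using ([]; _∷_)
  open import Data.List.Relation.Unary.Unique.Propositional using (Unique)
  open import Data.List.Relation.Unary.Unique.Propositional.Properties using (upTo⁺; filter⁺)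
  open import Data.Vec.Base using (Vec; _∷_)
  open import Data.Vec.Relation.Unary.All as VecAll using (_∷_; [])
  open import Data.Product using (_,_; proj₁)
  open import Data.Sum using (inj₁; inj₂; [_,_]′)
  open import Relation.Nullary using (Dec; contradiction)
  open import Relation.Nullary.Decidable using (_×-dec_)
  open import Relation.Binary.PropositionalEquality using (refl; subst)
  open Coprimality using (coprime-*∣)

  private variable a b d m p : ℕ

  prime∤1 : Prime p → ¬ p ∣ 1
  prime∤1 p-prime p∣1 = nonTrivial⇒≢1 {{prime⇒nonTrivial p-prime}} (∣1⇒≡1 p∣1)

  prime∤⇒coprime : Prime p → ¬ p ∣ m → Coprime p m
  prime∤⇒coprime p-prime p∤m {e} (e∣p , e∣m) with prime⇒irreducible p-prime e∣p
  ... | inj₁ e≡1  = e≡1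
  ... | inj₂ refl = contradiction e∣m p∤m

  product-distinctPrimes-∣ : ∀ {ps} → Unique ps → All (λ p → Prime p × p ∣ d) ps → product ps ∣ d
  product-distinctPrimes-∣ []            []                    = 1∣ _
  product-distinctPrimes-∣ {ps = p ∷ ps} (p∉ps ∷ uniq) ((p-prime , p∣d) ∷ h) =
    coprime-*∣ (prime∤⇒coprime p-prime p∤product) p∣d (product-distinctPrimes-∣ uniq h)
    where
    p∤product : ¬ p ∣ product ps
    p∤product p∣product =
      All.lookup p∉ps (factorisationHasAllPrimeFactors p-prime p∣product (All.map proj₁ h)) refl

  _RadDivides_ : ℕ → ℕ → Set
  m RadDivides d = ∀ {p} → Prime p → p ∣ m → p ∣ d

  rad∣ : m RadDivides d → rad m ∣ d
  rad∣ {m} h = product-distinctPrimes-∣ (filter⁺ P? (upTo⁺ (suc m)))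
    (All.map (λ (p-prime , p∣m) → p-prime , h p-prime p∣m) (all-filter P? (upTo (suc m))))
    where
    P? : ∀ p → Dec (Prime p × p ∣ m)
    P? p = prime? p ×-dec (p ∣? m)

  1-radDivides : 1 RadDivides d
  1-radDivides p-prime p∣1 = contradiction p∣1 (prime∤1 p-prime)

  ∣⇒radDivides : m ∣ d → m RadDivides d
  ∣⇒radDivides m∣d _ p∣m = ∣-trans p∣m m∣d

  radDivides-∣ : m RadDivides a → a ∣ d → m RadDivides d
  radDivides-∣ h a∣d p-prime p∣m = ∣-trans (h p-prime p∣m) a∣d

  radDivides-* : a RadDivides d → b RadDivides d → (a * b) RadDivides d
  radDivides-* {a = a} {b = b} ha hb p-prime p∣ab =
    [ ha p-prime , hb p-prime ]′ (euclidsLemma a b p-prime p∣ab)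

  radDivides-^ : ∀ k → a RadDivides d → (a ^ k) RadDivides d
  radDivides-^ zero    _ = 1-radDivides
  radDivides-^ (suc k) h = radDivides-* h (radDivides-^ k h)

  radDivides-prodℤ : ∀ {n} {xs : Vec ℤ n} → VecAll.All (λ x → ℤ.∣ x ∣ RadDivides d) xs →
                     ℤ.∣ prodℤ xs ∣ RadDivides d
  radDivides-prodℤ []                                  = 1-radDivides
  radDivides-prodℤ {xs = x ∷ xs} (hx ∷ h) p-prime p∣ =
    radDivides-* hx (radDivides-prodℤ h) p-prime (subst (_ ∣_) (abs-* x (prodℤ xs)) p∣)

module Powers where

  open import Data.Nat.Base
  open import Data.Nat.Properties
  open import Data.Nat.Tactic.RingSolver using (solve-∀)
  open import Data.Integer.Base as ℤ using (+_)
  import Data.Integer.Properties as ℤ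
  open import Data.Product using (∃-syntax; _,_)
  open import Relation.Binary.PropositionalEquality

  n<m^n : ∀ {m} → 1 < m → ∀ n → n < m ^ n
  n<m^n 1<m zero    = s≤s z≤n
  n<m^n {m@(suc _)} 1<m (suc n) = begin-strict
    suc n     ≤⟨ n<m^n 1<m n ⟩
    m ^ n     <⟨ m<m*n (m ^ n) m {{m^n≢0 m n}} 1<m ⟩
    m ^ n * m ≡⟨ *-comm (m ^ n) m ⟩
    m ^ suc n ∎
    where open ≤-Reasoning

  [1+m]^n≡1+m*q : ∀ m n → ∃[ q ] suc m ^ n ≡ suc (m * q)
  [1+m]^n≡1+m*q m zero    = 0 , cong suc (sym (*-zeroʳ m))
  [1+m]^n≡1+m*q m (suc n) =
    let q , eq = [1+m]^n≡1+m*q m n in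
    q + suc (m * q) , trans (cong (suc m *_) eq) (identity m q)
    where
    identity : ∀ m q → suc m * suc (m * q) ≡ suc (m * (q + suc (m * q)))
    identity = solve-∀

  pos-^ : ∀ m k → + (m ^ k) ≡ (+ m) ℤ.^ k
  pos-^ m zero    = refl
  pos-^ m (suc k) = trans (ℤ.pos-* m (m ^ k)) (cong ((+ m) ℤ.*_) (pos-^ m k))

module Integers where

  import Data.Nat.Base as ℕ
  import Data.Nat.Properties as ℕ
  import Data.Nat.Divisibility as ℕ
  open import Data.Integer.Base
  open import Data.Integer.Properties
  open import Data.Integer.Divisibility.Signed
  open import Data.Integer.Tactic.RingSolver using (solve-∀)
  open import Data.Product using (_,_)
  open import Data.Sum using ([_,_]′)
  open import Function.Base using (id)
  open import Relation.Nullary using (contradiction)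
  open import Relation.Binary.PropositionalEquality
  open ≡-Reasoning

  ∣u-1⇒∣u^3-1 : ∀ {d u} → d ∣ u - 1ℤ → d ∣ u ^ 3 - 1ℤ
  ∣u-1⇒∣u^3-1 {u = u} d∣u-1 = subst (_ ∣_) (identity u) (∣m⇒∣m*n (u * u + u + 1ℤ) d∣u-1)
    where
    identity : ∀ u → (u - 1ℤ) * (u * u + u + 1ℤ) ≡ u * (u * (u * 1ℤ)) - 1ℤ
    identity = solve-∀

  ∣v+1⇒∣v^3+1 : ∀ {d v} → d ∣ v + 1ℤ → d ∣ v ^ 3 + 1ℤ
  ∣v+1⇒∣v^3+1 {v = v} d∣v+1 = subst (_ ∣_) (identity v) (∣m⇒∣m*n (v * v - v + 1ℤ) d∣v+1)
    where
    identity : ∀ v → (v + 1ℤ) * (v * v - v + 1ℤ) ≡ v * (v * (v * 1ℤ)) + 1ℤ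
    identity = solve-∀

  i+n*j≡0⇒i≡0 : ∀ {i j n} → ∣ i ∣ ℕ.< n → i + + n * j ≡ 0ℤ → i ≡ 0ℤ
  i+n*j≡0⇒i≡0 {i} {j} {n} ∣i∣<n eq =
    ∣i∣≡0⇒i≡0 (trans ∣i∣≡n*∣j∣ (trans (cong (n ℕ.*_) ∣j∣≡0) (ℕ.*-zeroʳ n)))
    where
    identity : ∀ a b → a ≡ - b + (a + b)
    identity = solve-∀
    i≡-nj : i ≡ - (+ n * j)
    i≡-nj = begin
      i                           ≡⟨ identity i (+ n * j) ⟩
      - (+ n * j) + (i + + n * j) ≡⟨ cong (_+_ (- (+ n * j))) eq ⟩
      - (+ n * j) + 0ℤ            ≡⟨ +-identityʳ _ ⟩
      - (+ n * j)                 ∎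
    ∣i∣≡n*∣j∣ : ∣ i ∣ ≡ n ℕ.* ∣ j ∣
    ∣i∣≡n*∣j∣ = trans (cong ∣_∣ i≡-nj) (trans (∣-i∣≡∣i∣ (+ n * j)) (abs-* (+ n) j))
    ∣j∣≡0 : ∣ j ∣ ≡ 0
    ∣j∣≡0 = ℕ.n<1⇒n≡0 (ℕ.*-cancelˡ-< n ∣ j ∣ 1
              (subst₂ ℕ._<_ ∣i∣≡n*∣j∣ (sym (ℕ.*-identityʳ n)) ∣i∣<n))

  i+n*[j+k*l]≡0⇒i≡0×j≡0 : ∀ {i j l n k} → ∣ i ∣ ℕ.< n → ∣ j ∣ ℕ.< k →
                          i + + n * (j + + k * l) ≡ 0ℤ → i ≡ 0ℤ × j ≡ 0ℤ
  i+n*[j+k*l]≡0⇒i≡0×j≡0 {i} {j} {l} {n} {k} ∣i∣<n ∣j∣<k eq = i≡0 , i+n*j≡0⇒i≡0 ∣j∣<k j+kl≡0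
    where
    i≡0 : i ≡ 0ℤ
    i≡0 = i+n*j≡0⇒i≡0 ∣i∣<n eq
    n[j+kl]≡0 : + n * (j + + k * l) ≡ 0ℤ
    n[j+kl]≡0 = trans (sym (+-identityˡ _)) (trans (cong (_+ _) (sym i≡0)) eq)
    j+kl≡0 : j + + k * l ≡ 0ℤ
    j+kl≡0 = [ (λ n≡0 → contradiction (+-injective n≡0) (ℕ.m<n⇒n≢0 ∣i∣<n)) , id ]′
               (i*j≡0⇒i≡0∨j≡0 (+ n) n[j+kl]≡0)

  small-residue⇒∤ : ∀ {f x r} → 0 ℕ.< ∣ r ∣ → ∣ r ∣ ℕ.< f → + f ∣ x - r → ¬ f ℕ.∣ ∣ x ∣
  small-residue⇒∤ {f} {x} {r} 0<∣r∣ ∣r∣<f f∣x-r f∣x =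
    ℕ.<⇒≱ ∣r∣<f (ℕ.∣⇒≤ {{ℕ.>-nonZero 0<∣r∣}} (∣⇒∣ᵤ f∣r))
    where
    identity : ∀ x r → x - (x - r) ≡ r
    identity = solve-∀
    f∣r : + f ∣ r
    f∣r = subst (+ f ∣_) (identity x r) (∣m∣n⇒∣m-n (∣ᵤ⇒∣ {+ f} {x} f∣x) f∣x-r)

module Quality where

  open import Data.Nat.Base
  open import Data.Nat.Properties
  open import Data.Nat.ListAction using (sum)
  open import Data.Integer.Base as ℤ using (ℤ)
  open import Data.Fin.Base using (zero; suc)
  open import Data.List.Base using (map)
  open import Data.List.Relation.Unary.Any using (here; there)
  open import Data.Vec.Base using (Vec; _∷_; lookup)
  open import Relation.Binary.PropositionalEquality using (refl)

  ∣lookup∣≤maxAbs : ∀ {k} (a : Vec ℤ k) i → ℤ.∣ lookup a i ∣ ≤ maxAbs a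
  ∣lookup∣≤maxAbs (x ∷ a) zero    = m≤m⊔n ℤ.∣ x ∣ (maxAbs a)
  ∣lookup∣≤maxAbs (x ∷ a) (suc i) = ≤-trans (∣lookup∣≤maxAbs a i) (m≤n⊔m ℤ.∣ x ∣ (maxAbs a))

  ∈⇒≤sum : ∀ {A : Set} (f : A → ℕ) {x xs} → x ∈ xs → f x ≤ sum (map f xs)
  ∈⇒≤sum f (here refl)  = m≤m+n _ _
  ∈⇒≤sum f (there x∈xs) = ≤-trans (∈⇒≤sum f x∈xs) (m≤n+m _ _)

  maxAbs-∉ : ∀ {a : Tuple5} {S} → sum (map maxAbs S) < maxAbs a → ¬ a ∈ S
  maxAbs-∉ sum<max a∈S = <⇒≱ sum<max (∈⇒≤sum maxAbs a∈S)

  qualityAbove-6/5 : ∀ {k} (a : Vec ℤ k) {X} → rad ℤ.∣ prodℤ a ∣ < X ^ 5 → X ^ 6 ≤ maxAbs a →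
                     QualityAbove a 1 5
  qualityAbove-6/5 a {X} rad<X⁵ X⁶≤max = begin-strict
    rad ℤ.∣ prodℤ a ∣ ^ 6 <⟨ ^-monoˡ-< 6 rad<X⁵ ⟩
    (X ^ 5) ^ 6           ≡⟨ ^-*-assoc X 5 6 ⟩
    X ^ 30                ≡⟨ ^-*-assoc X 6 5 ⟨
    (X ^ 6) ^ 5           ≤⟨ ^-monoˡ-≤ 5 X⁶≤max ⟩
    maxAbs a ^ 5          ∎
    where open ≤-Reasoning

module TupleFamily where

  import Data.Nat.Base as ℕ
  import Data.Nat.Properties as ℕ
  import Data.Nat.Divisibility as ℕ
  open import Data.Integer.Base hiding (suc)
  open import Data.Integer.Properties
  open import Data.Integer.Divisibility.Signed
  open import Data.Integer.Tactic.RingSolver using (solve-∀)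
  open import Data.Fin.Base using (Fin; zero; suc)
  open import Data.Fin.Properties using (any?) renaming (all? to allFin?)
  open import Data.List.Base using (_∷_)
  open import Data.List.Relation.Unary.All using (all?) renaming (lookup to lookupᴬ)
  open import Data.List.Relation.Unary.Any using (here; there)
  open import Data.Vec.Base using (_∷_; []; lookup)
  open import Data.Product using (_,_; proj₁; proj₂)
  open import Data.Sum using (_⊎_; inj₁; inj₂; [_,_]′)
  open import Function.Base using (_∘_)
  open import Relation.Nullary using (Dec)
  open import Relation.Nullary.Decidable using (_×-dec_; _⊎-dec_; _→-dec_; ¬?; from-yes)
  open import Relation.Binary.PropositionalEquality
  open ≡-Reasoning
  open Integers

  tuple : ℤ → ℤ → ℤ → Tuple5
  tuple N u v = u ∷ v ∷ - (+ 2 + u + v) ∷ 1ℤ + N ∷ 1ℤ - N ∷ []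

  ∣1-[1+n]∣≡n : ∀ n → ∣ 1ℤ - + ℕ.suc n ∣ ≡ n
  ∣1-[1+n]∣≡n ℕ.zero    = refl
  ∣1-[1+n]∣≡n (ℕ.suc n) = refl

  tuple-sum : ∀ N u v → sumℤ (tuple N u v) ≡ 0ℤ
  tuple-sum N u v = identity N u v
    where
    identity : ∀ N u v → u + (v + (- (+ 2 + u + v) + ((1ℤ + N) + ((1ℤ - N) + 0ℤ)))) ≡ 0ℤ
    identity = solve-∀

  ρ : Tuple5
  ρ = 1ℤ ∷ -1ℤ ∷ - + 2 ∷ 1ℤ ∷ 1ℤ ∷ []

  tuple≡ρ : ∀ {N u v} → N ∣ u - 1ℤ → N ∣ v + 1ℤ → ∀ i → N ∣ lookup (tuple N u v) i - lookup ρ i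
  tuple≡ρ N∣u-1 _     zero                         = N∣u-1
  tuple≡ρ _     N∣v+1 (suc zero)                   = N∣v+1
  tuple≡ρ {N} {u} {v} N∣u-1 N∣v+1 (suc (suc zero)) =
    subst (N ∣_) (identity u v) (∣m⇒∣-m (∣m∣n⇒∣m+n N∣u-1 N∣v+1))
    where
    identity : ∀ u v → - ((u - 1ℤ) + (v + 1ℤ)) ≡ - (+ 2 + u + v) - - + 2
    identity = solve-∀
  tuple≡ρ {N} _ _ (suc (suc (suc zero)))           = subst (N ∣_) (identity N) ∣-refl
    where
    identity : ∀ N → N ≡ 1ℤ + N - 1ℤ
    identity = solve-∀
  tuple≡ρ {N} _ _ (suc (suc (suc (suc zero))))     = subst (N ∣_) (identity N) (∣m⇒∣-m ∣-refl)
    where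
    identity : ∀ N → - N ≡ 1ℤ - N - 1ℤ
    identity = solve-∀

  ρ-bounds : ∀ i → 0 ℕ.< ∣ lookup ρ i ∣ × ∣ lookup ρ i ∣ ℕ.< 3
  ρ-bounds = from-yes (allFin? λ i → (0 ℕ.<? ∣ lookup ρ i ∣) ×-dec (∣ lookup ρ i ∣ ℕ.<? 3))

  tuple-noMultiple : ∀ {f N u v} → 3 ℕ.≤ f → f ℕ.∣ N → + N ∣ u - 1ℤ → + N ∣ v + 1ℤ →
                     ∀ i → ¬ f ℕ.∣ ∣ lookup (tuple (+ N) u v) i ∣
  tuple-noMultiple {N = N} {u} {v} 3≤f f∣N N∣u-1 N∣v+1 i =
    small-residue⇒∤ {x = lookup (tuple (+ N) u v) i}
      (proj₁ (ρ-bounds i)) (ℕ.<-≤-trans (proj₂ (ρ-bounds i)) 3≤f)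
      (∣-trans (∣ᵤ⇒∣ f∣N) (tuple≡ρ {u = u} {v} N∣u-1 N∣v+1 i))

  residue carry coeff₁ coeff₂ : Tuple5 → ℤ
  residue b = dot b ρ
  carry  (b₁ ∷ b₂ ∷ b₃ ∷ b₄ ∷ b₅ ∷ []) = b₄ - b₅
  coeff₁ (b₁ ∷ b₂ ∷ b₃ ∷ b₄ ∷ b₅ ∷ []) = b₁ - b₃
  coeff₂ (b₁ ∷ b₂ ∷ b₃ ∷ b₄ ∷ b₅ ∷ []) = b₂ - b₃

  dot-tuple : ∀ N u v b → dot b (tuple N u v) ≡
              residue b + N * carry b + coeff₁ b * (u - 1ℤ) + coeff₂ b * (v + 1ℤ)
  dot-tuple N u v (b₁ ∷ b₂ ∷ b₃ ∷ b₄ ∷ b₅ ∷ []) = identity b₁ b₂ b₃ b₄ b₅ N u v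
    where
    identity : ∀ b₁ b₂ b₃ b₄ b₅ N u v →
      b₁ * u + (b₂ * v + (b₃ * - (+ 2 + u + v) + (b₄ * (1ℤ + N) + (b₅ * (1ℤ - N) + 0ℤ))))
      ≡ b₁ * 1ℤ + (b₂ * -1ℤ + (b₃ * - + 2 + (b₄ * 1ℤ + (b₅ * 1ℤ + 0ℤ)))) + N * (b₄ - b₅)
        + (b₁ - b₃) * (u - 1ℤ) + (b₂ - b₃) * (v + 1ℤ)
    identity = solve-∀

  dot-tuple-reduced : ∀ N u v b → residue b ≡ 0ℤ → carry b ≡ 0ℤ →
                      dot b (tuple N u v) ≡ coeff₁ b * (u - 1ℤ) + coeff₂ b * (v + 1ℤ)
  dot-tuple-reduced N u v b residue≡0 carry≡0 = begin
    dot b (tuple N u v)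
      ≡⟨ dot-tuple N u v b ⟩
    residue b + N * carry b + coeff₁ b * (u - 1ℤ) + coeff₂ b * (v + 1ℤ)
      ≡⟨ cong₂ (λ r t → r + N * t + coeff₁ b * (u - 1ℤ) + coeff₂ b * (v + 1ℤ)) residue≡0 carry≡0 ⟩
    0ℤ + N * 0ℤ + coeff₁ b * (u - 1ℤ) + coeff₂ b * (v + 1ℤ)
      ≡⟨ identity N (coeff₁ b * (u - 1ℤ)) (coeff₂ b * (v + 1ℤ)) ⟩
    coeff₁ b * (u - 1ℤ) + coeff₂ b * (v + 1ℤ) ∎
    where
    identity : ∀ N x y → 0ℤ + N * 0ℤ + x + y ≡ x + y
    identity = solve-∀

  -- the coefficient pairs (p, q) left over once a vanishing subsum is reduced modulo N and N² − 1
  Shape : ℤ → ℤ → Set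
  Shape p q = (p ≡ q ⊎ p ≡ - q ⊎ p ≡ 0ℤ) × q ≢ 0ℤ

  shape? : ∀ p q → Dec (Shape p q)
  shape? p q = ((p ≟ q) ⊎-dec (p ≟ - q) ⊎-dec (p ≟ 0ℤ)) ×-dec ¬? (q ≟ 0ℤ)

  shape⇒≢0 : ∀ {p q x y} → Shape p q → x + y ≢ 0ℤ → x ≢ y → y ≢ 0ℤ → p * x + q * y ≢ 0ℤ
  shape⇒≢0 {q = q} {x} {y} (inj₁ refl , q≢0) x+y≢0 _ _ eq =
    [ q≢0 , x+y≢0 ]′ (i*j≡0⇒i≡0∨j≡0 q (trans (*-distribˡ-+ q x y) eq))
  shape⇒≢0 {q = q} {x} {y} (inj₂ (inj₁ refl) , q≢0) _ x≢y _ eq =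
    [ q≢0 , (λ y-x≡0 → x≢y (sym (i-j≡0⇒i≡j y x y-x≡0))) ]′
      (i*j≡0⇒i≡0∨j≡0 q (trans (identity q x y) eq))
    where
    identity : ∀ q x y → q * (y - x) ≡ - q * x + q * y
    identity = solve-∀
  shape⇒≢0 {q = q} {x} {y} (inj₂ (inj₂ refl) , q≢0) _ _ y≢0 eq =
    [ q≢0 , y≢0 ]′ (i*j≡0⇒i≡0∨j≡0 q (trans (identity q x y) eq))
    where
    identity : ∀ q x y → q * y ≡ 0ℤ * x + q * y
    identity = solve-∀

  HasZero HasOne : Tuple5 → Set
  HasZero b = ∃ λ i → lookup b i ≡ 0ℤ
  HasOne  b = ∃ λ j → lookup b j ≡ 1ℤ

  SubsumShape : Tuple5 → Set
  SubsumShape b = ∣ residue b ∣ ℕ.≤ 6 × ∣ carry b ∣ ℕ.≤ 2 ×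
    (HasZero b → HasOne b → residue b ≡ 0ℤ → carry b ≡ 0ℤ → Shape (coeff₁ b) (coeff₂ b))

  subsumShape? : ∀ b → Dec (SubsumShape b)
  subsumShape? b = (∣ residue b ∣ ℕ.≤? 6) ×-dec (∣ carry b ∣ ℕ.≤? 2) ×-dec
    (any? (λ i → lookup b i ≟ 0ℤ) →-dec any? (λ j → lookup b j ≟ 1ℤ) →-dec
     residue b ≟ 0ℤ →-dec carry b ≟ 0ℤ →-dec shape? (coeff₁ b) (coeff₂ b))

  signs : List ℤ
  signs = -1ℤ ∷ 0ℤ ∷ 1ℤ ∷ []

  isSign⇒∈signs : ∀ {b} → IsSign b → b ∈ signs
  isSign⇒∈signs (inj₁ refl)        = here refl
  isSign⇒∈signs (inj₂ (inj₁ refl)) = there (here refl)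
  isSign⇒∈signs (inj₂ (inj₂ refl)) = there (there (here refl))

  ForAllSignVectors : (Tuple5 → Set) → Set
  ForAllSignVectors P = All (λ b₁ → All (λ b₂ → All (λ b₃ → All (λ b₄ → All (λ b₅ →
    P (b₁ ∷ b₂ ∷ b₃ ∷ b₄ ∷ b₅ ∷ [])) signs) signs) signs) signs) signs

  forAllSignVectors? : ∀ {P} → (∀ b → Dec (P b)) → Dec (ForAllSignVectors P)
  forAllSignVectors? P? =
    all? (λ _ → all? (λ _ → all? (λ _ → all? (λ _ → all? (λ _ → P? _) signs) signs) signs) signs) signs

  forAllSignVectors-lookup : ∀ {P} → ForAllSignVectors P →
                             (b : Tuple5) → ((k : Fin 5) → IsSign (lookup b k)) → P b
  forAllSignVectors-lookup h (b₁ ∷ b₂ ∷ b₃ ∷ b₄ ∷ b₅ ∷ []) b-signs =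
    lookupᴬ (lookupᴬ (lookupᴬ (lookupᴬ (lookupᴬ h (∈signs zero)) (∈signs (suc zero)))
      (∈signs (suc (suc zero)))) (∈signs (suc (suc (suc zero))))) (∈signs (suc (suc (suc (suc zero)))))
    where
    ∈signs : ∀ k → lookup (b₁ ∷ b₂ ∷ b₃ ∷ b₄ ∷ b₅ ∷ []) k ∈ signs
    ∈signs k = isSign⇒∈signs (b-signs k)

  signVector-subsumShape : (b : Tuple5) → ((k : Fin 5) → IsSign (lookup b k)) → SubsumShape b
  signVector-subsumShape =
    forAllSignVectors-lookup {SubsumShape} (from-yes (forAllSignVectors? subsumShape?))

  module _ {N K : ℕ} {u v : ℤ} (6<N : 6 ℕ.< N) (2<K : 2 ℕ.< K)
           (NK∣u-1 : + N * + K ∣ u - 1ℤ) (NK∣v+1 : + N * + K ∣ v + 1ℤ)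
           (u+v≢0 : u + v ≢ 0ℤ) (u-1≢v+1 : u - 1ℤ ≢ v + 1ℤ) (v+1≢0 : v + 1ℤ ≢ 0ℤ) where

    dot-tuple-mod-NK : ∀ b → ∃ λ z → dot b (tuple (+ N) u v) ≡ residue b + + N * (carry b + + K * z)
    dot-tuple-mod-NK b = coeff₁ b * α + coeff₂ b * β , (begin
      dot b (tuple (+ N) u v)
        ≡⟨ dot-tuple (+ N) u v b ⟩
      residue b + + N * carry b + coeff₁ b * (u - 1ℤ) + coeff₂ b * (v + 1ℤ)
        ≡⟨ cong₂ (λ x y → residue b + + N * carry b + coeff₁ b * x + coeff₂ b * y)
                 (_∣_.equality NK∣u-1) (_∣_.equality NK∣v+1) ⟩
      residue b + + N * carry b + coeff₁ b * (α * (+ N * + K)) + coeff₂ b * (β * (+ N * + K))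
        ≡⟨ identity (residue b) (carry b) (coeff₁ b) (coeff₂ b) α β (+ N) (+ K) ⟩
      residue b + + N * (carry b + + K * (coeff₁ b * α + coeff₂ b * β)) ∎)
      where
      α β : ℤ
      α = quotient NK∣u-1
      β = quotient NK∣v+1
      identity : ∀ r t c₁ c₂ α β N K →
        r + N * t + c₁ * (α * (N * K)) + c₂ * (β * (N * K)) ≡ r + N * (t + K * (c₁ * α + c₂ * β))
      identity = solve-∀

    tuple-noVanishingSubsum : (b : Tuple5) → ((k : Fin 5) → IsSign (lookup b k)) →
                              HasZero b → HasOne b → dot b (tuple (+ N) u v) ≢ 0ℤ
    tuple-noVanishingSubsum b b-signs b-zero b-one dot≡0 with signVector-subsumShape b b-signs
    ... | ∣residue∣≤6 , ∣carry∣≤2 , shape =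
      shape⇒≢0 (shape b-zero b-one residue≡0 carry≡0) x+y≢0 u-1≢v+1 v+1≢0
        (trans (sym (dot-tuple-reduced (+ N) u v b residue≡0 carry≡0)) dot≡0)
      where
      residue≡0×carry≡0 : residue b ≡ 0ℤ × carry b ≡ 0ℤ
      residue≡0×carry≡0 = i+n*[j+k*l]≡0⇒i≡0×j≡0 (ℕ.≤-<-trans ∣residue∣≤6 6<N) (ℕ.≤-<-trans ∣carry∣≤2 2<K)
                            (trans (sym (proj₂ (dot-tuple-mod-NK b))) dot≡0)
      residue≡0 : residue b ≡ 0ℤ
      residue≡0 = proj₁ residue≡0×carry≡0
      carry≡0 : carry b ≡ 0ℤ
      carry≡0 = proj₂ residue≡0×carry≡0
      identity : ∀ u v → u + v ≡ (u - 1ℤ) + (v + 1ℤ)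
      identity = solve-∀
      x+y≢0 : (u - 1ℤ) + (v + 1ℤ) ≢ 0ℤ
      x+y≢0 = u+v≢0 ∘ trans (identity u v)

open import Data.Nat using (suc)
open import Data.Nat.Divisibility using (_∣_)

module Construction (n : ℕ) (2∣N : 2 ∣ suc n) (6<N : 6 < suc n) where

  open import Data.Nat.Base
  open import Data.Nat.Properties
  open import Data.Nat.Divisibility
  open import Data.Nat.Coprimality using (Coprime; coprime⇒gcd≡1) renaming (sym to coprime-sym)
  open import Data.Nat.Tactic.RingSolver using (solve-∀)
  open import Data.Integer.Base as ℤ using (+_; 1ℤ)
  import Data.Integer.Properties as ℤ
  import Data.Integer.Divisibility.Signed as ℤ
  open import Data.Integer.Tactic.RingSolver using () renaming (solve-∀ to solveℤ-∀)
  open import Data.Fin.Base using (zero; suc)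
  import Data.List.Relation.Unary.All as List
  open import Data.Vec.Base using (Vec; _∷_; []; map)
  open import Data.Vec.Properties using (lookup-map)
  open import Data.Vec.Relation.Unary.All as VecAll using (_∷_; [])
  import Data.Vec.Relation.Unary.All.Properties as VecAll
  open import Data.Vec.Relation.Unary.AllPairs using (AllPairs; _∷_; [])
  open import Data.Product using (∃-syntax; _,_)
  open import Relation.Nullary using (contradiction)
  open import Relation.Binary.PropositionalEquality
  open Coprimality
  open Radical
  open Powers
  open Integers using (∣u-1⇒∣u^3-1; ∣v+1⇒∣v^3+1)
  open Quality using (∣lookup∣≤maxAbs; qualityAbove-6/5)
  open TupleFamily using (tuple; ∣1-[1+n]∣≡n; tuple-sum; tuple-noVanishingSubsum; tuple-noMultiple)

  N K M P C : ℕ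
  N = suc n
  K = (2 + n) * n
  M = N * K
  P = suc M
  -- rad (2 X⁶ (N + 1) (N − 1)) divides C when rad X ∣ P
  C = 2 * P * (2 + n) * n

  instance
    n≢0 : NonZero n
    n≢0 = >-nonZero (≤-trans (s≤s z≤n) (s≤s⁻¹ 6<N))

  2<K : 2 < K
  2<K = <-≤-trans (≤-trans (s≤s (s≤s (s≤s z≤n))) (s≤s⁻¹ 6<N)) (m≤n*m n (2 + n))

  1<P : 1 < P
  1<P = s≤s (>-nonZero⁻¹ M {{m*n≢0 N K {{_}} {{m*n≢0 (2 + n) n}}}})

  2∣M : 2 ∣ M
  2∣M = ∣-trans 2∣N (m∣m*n K)

  N+1∣M : 2 + n ∣ M
  N+1∣M = ∣-trans (m∣m*n n) (n∣m*n N)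

  N-1∣M : n ∣ M
  N-1∣M = ∣-trans (n∣m*n (2 + n)) (n∣m*n N)

  N+1⊥2 : Coprime (2 + n) 2
  N+1⊥2 = coprime-≡1 2∣N

  N-1⊥2 : Coprime n 2
  N-1⊥2 = coprime-≡-1 2∣N

  N+1⊥N-1 : Coprime (2 + n) n
  N+1⊥N-1 {d} (d∣N+1 , d∣n) = N-1⊥2 (d∣n , ∣m+n∣m⇒∣n (subst (d ∣_) (+-comm 2 n) d∣N+1) d∣n)

  arbitrarilyLargeX : ∀ bound → ∃[ w ] M ∣ suc w × (2 + w) RadDivides P × bound < 2 + w
  arbitrarilyLargeX bound = large ([1+m]^n≡1+m*q M m)
    where
    m : ℕ
    m = suc bound
    m<P^m : m < P ^ m
    m<P^m = n<m^n 1<P m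
    large : ∃[ q ] P ^ m ≡ suc (M * q) → ∃[ w ] M ∣ suc w × (2 + w) RadDivides P × bound < 2 + w
    large (q , P^m≡1+Mq) with M * q | P^m≡1+Mq | m∣m*n {M} q
    ... | zero  | P^m≡1 | _     = contradiction P^m≡1 (>⇒≢ (≤-<-trans (s≤s z≤n) m<P^m))
    ... | suc w | P^m≡X | M∣X-1 =
      w , M∣X-1 , subst (_RadDivides P) P^m≡X (radDivides-^ m (∣⇒radDivides ∣-refl)) ,
      subst (bound <_) P^m≡X (<-trans (n<1+n bound) m<P^m)

  module Witness (w : ℕ) (M∣X-1 : M ∣ suc w) (rad[X]∣P : (2 + w) RadDivides P) (C<X : C < 2 + w) where

    X A B : ℕ
    X = 2 + w
    -- X² + X − 1 and X² − X − 1, written without subtraction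
    A = suc (suc w * (4 + w))
    B = suc (w * (3 + w))

    a : Tuple5
    a = tuple (+ N) (+ (A ^ 3)) (+ (B ^ 3))

    1+A≡X[X+1] : suc A ≡ X * (3 + w)
    1+A≡X[X+1] = identity w
      where
      identity : ∀ w → suc (suc (suc w * (4 + w))) ≡ (2 + w) * (3 + w)
      identity = solve-∀

    1+B≡X[X-1] : suc B ≡ X * suc w
    1+B≡X[X-1] = identity w
      where
      identity : ∀ w → suc (suc (w * (3 + w))) ≡ (2 + w) * suc w
      identity = solve-∀

    A≡B+2X : A ≡ B + 2 * X
    A≡B+2X = identity w
      where
      identity : ∀ w → suc (suc w * (4 + w)) ≡ suc (w * (3 + w)) + 2 * (2 + w)
      identity = solve-∀

    2+A³+B³≡2X⁶ : 2 + A ^ 3 + B ^ 3 ≡ 2 * X ^ 6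
    2+A³+B³≡2X⁶ = identity w
      where
      identity : ∀ w → let a = suc (suc w * (4 + w)); b = suc (w * (3 + w)); x = 2 + w in
        2 + a * (a * (a * 1)) + b * (b * (b * 1)) ≡ 2 * (x * (x * (x * (x * (x * (x * 1))))))
      identity = solve-∀

    AB≤X⁴ : A * B ≤ X ^ 4
    AB≤X⁴ = subst (A * B ≤_) (identity w) (m≤m+n (A * B) (11 + 12 * w + 3 * w * w))
      where
      identity : ∀ w → let x = 2 + w in
        suc (suc w * (4 + w)) * suc (w * (3 + w)) + (11 + 12 * w + 3 * w * w) ≡ x * (x * (x * (x * 1)))
      identity = solve-∀

    2+B³<A³ : 2 + B ^ 3 < A ^ 3
    2+B³<A³ = begin-strict
      2 + B ^ 3                            <⟨ m≤m+n (3 + B ^ 3) (5 + 12 * B + 6 * B * B) ⟩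
      3 + B ^ 3 + (5 + 12 * B + 6 * B * B) ≡⟨ cube B ⟩
      (2 + B) ^ 3                          ≤⟨ ^-monoˡ-≤ 3 2+B≤A ⟩
      A ^ 3                                ∎
      where
      open ≤-Reasoning
      cube : ∀ b → 3 + b * (b * (b * 1)) + (5 + 12 * b + 6 * b * b) ≡ (2 + b) * ((2 + b) * ((2 + b) * 1))
      cube = solve-∀
      identity : ∀ w → 2 + suc (w * (3 + w)) + 2 * suc w ≡ suc (suc w * (4 + w))
      identity = solve-∀
      2+B≤A : 2 + B ≤ A
      2+B≤A = subst (2 + B ≤_) (identity w) (m≤m+n (2 + B) (2 * suc w))

    A⊥ : ∀ {d} → d ∣ M → Coprime A d
    A⊥ d∣M = coprime-≡1 (∣-trans d∣M (∣-trans M∣X-1 (m∣m*n (4 + w))))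

    B⊥ : ∀ {d} → d ∣ M → Coprime B d
    B⊥ d∣M = coprime-≡-1 (∣-trans d∣M (∣-trans M∣X-1 (subst (suc w ∣_) (sym 1+B≡X[X-1]) (n∣m*n X))))

    X⊥ : ∀ {d} → d ∣ M → Coprime X d
    X⊥ d∣M = coprime-≡1 (∣-trans d∣M M∣X-1)

    A⊥X : Coprime A X
    A⊥X = coprime-≡-1 (subst (X ∣_) (sym 1+A≡X[X+1]) (m∣m*n (3 + w)))

    B⊥X : Coprime B X
    B⊥X = coprime-≡-1 (subst (X ∣_) (sym 1+B≡X[X-1]) (m∣m*n (suc w)))

    A⊥B : Coprime A B
    A⊥B {d} (d∣A , d∣B) =
      coprime-*ʳ (A⊥ 2∣M) A⊥X (d∣A , ∣m+n∣m⇒∣n (subst (d ∣_) A≡B+2X d∣A) d∣B)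

    ⊥2X⁶ : ∀ {c} → Coprime c 2 → Coprime c X → Coprime c (2 * X ^ 6)
    ⊥2X⁶ c⊥2 c⊥X = coprime-*ʳ c⊥2 (coprime-^ʳ 6 c⊥X)

    ∣a∣ : Vec ℕ 5
    ∣a∣ = A ^ 3 ∷ B ^ 3 ∷ 2 * X ^ 6 ∷ 2 + n ∷ n ∷ []

    map-∣∣-a : map ℤ.∣_∣ a ≡ ∣a∣
    map-∣∣-a = cong₂ (λ t m → A ^ 3 ∷ B ^ 3 ∷ t ∷ 2 + n ∷ m ∷ []) 2+A³+B³≡2X⁶ (∣1-[1+n]∣≡n n)

    ∣a∣-pairwiseCoprime : AllPairs Coprime ∣a∣
    ∣a∣-pairwiseCoprime =
        (coprime-^ˡ 3 (coprime-^ʳ 3 A⊥B) ∷ coprime-^ˡ 3 (⊥2X⁶ (A⊥ 2∣M) A⊥X) ∷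
         coprime-^ˡ 3 (A⊥ N+1∣M) ∷ coprime-^ˡ 3 (A⊥ N-1∣M) ∷ [])
      ∷ (coprime-^ˡ 3 (⊥2X⁶ (B⊥ 2∣M) B⊥X) ∷ coprime-^ˡ 3 (B⊥ N+1∣M) ∷ coprime-^ˡ 3 (B⊥ N-1∣M) ∷ [])
      ∷ (coprime-*ˡ (coprime-sym N+1⊥2) (coprime-^ˡ 6 (X⊥ N+1∣M)) ∷
         coprime-*ˡ (coprime-sym N-1⊥2) (coprime-^ˡ 6 (X⊥ N-1∣M)) ∷ [])
      ∷ (N+1⊥N-1 ∷ [])
      ∷ [] ∷ []

    M∣u-1 : + M ℤ.∣ + (A ^ 3) ℤ.- 1ℤ
    M∣u-1 = subst (λ u → + M ℤ.∣ u ℤ.- 1ℤ) (sym (pos-^ A 3))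
      (∣u-1⇒∣u^3-1 {u = + A} (ℤ.∣ᵤ⇒∣ {+ M} {+ A ℤ.- 1ℤ} (∣-trans M∣X-1 (m∣m*n (4 + w)))))

    M∣v+1 : + M ℤ.∣ + (B ^ 3) ℤ.+ 1ℤ
    M∣v+1 = subst (λ v → + M ℤ.∣ v ℤ.+ 1ℤ) (sym (pos-^ B 3))
      (∣v+1⇒∣v^3+1 {v = + B} (ℤ.∣ᵤ⇒∣ {+ M} {+ B ℤ.+ 1ℤ} (∣-trans M∣X-1 X-1∣B+1)))
      where
      X-1∣B+1 : suc w ∣ B + 1
      X-1∣B+1 = subst (suc w ∣_) (trans (sym 1+B≡X[X-1]) (+-comm 1 B)) (n∣m*n X)

    N∣ : ∀ {x} → + M ℤ.∣ x → + N ℤ.∣ x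
    N∣ = ℤ.∣-trans (ℤ.∣ᵤ⇒∣ (m∣m*n K))

    NK∣ : ∀ {x} → + M ℤ.∣ x → + N ℤ.* + K ℤ.∣ x
    NK∣ = subst (ℤ._∣ _) (ℤ.pos-* N K)

    u-1≢v+1 : + (A ^ 3) ℤ.- 1ℤ ≢ + (B ^ 3) ℤ.+ 1ℤ
    u-1≢v+1 eq = <⇒≢ 2+B³<A³ (sym (ℤ.+-injective (begin
      + (A ^ 3)               ≡⟨ identity₁ (+ (A ^ 3)) ⟩
      + (A ^ 3) ℤ.- 1ℤ ℤ.+ 1ℤ ≡⟨ cong (ℤ._+ 1ℤ) eq ⟩
      + (B ^ 3) ℤ.+ 1ℤ ℤ.+ 1ℤ ≡⟨ identity₂ (+ (B ^ 3)) ⟩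
      + 2 ℤ.+ + (B ^ 3)       ∎)))
      where
      open ≡-Reasoning
      identity₁ : ∀ u → u ≡ u ℤ.- 1ℤ ℤ.+ 1ℤ
      identity₁ = solveℤ-∀
      identity₂ : ∀ v → v ℤ.+ 1ℤ ℤ.+ 1ℤ ≡ + 2 ℤ.+ v
      identity₂ = solveℤ-∀

    a-inU : ∀ {F} → All (3 ≤_) F → (∀ {f} → f ∈ F → f ∣ N) → InU F a
    a-inU F≥3 F∣N = record
      { coprime  = λ i j i≢j → cong +_ (coprime⇒gcd≡1 (subst₂ Coprime (lookup-map i ℤ.∣_∣ a)
                     (lookup-map j ℤ.∣_∣ a) (allPairs-lookup coprime-sym pairwiseCoprime i≢j)))
      ; sumZero  = tuple-sum (+ N) (+ (A ^ 3)) (+ (B ^ 3))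
      ; noSubsum = tuple-noVanishingSubsum 6<N 2<K (NK∣ M∣u-1) (NK∣ M∣v+1) (λ ()) u-1≢v+1 (λ ())
      ; noMult   = λ i f f∈F → tuple-noMultiple (List.lookup F≥3 f∈F) (F∣N f∈F) (N∣ M∣u-1) (N∣ M∣v+1) i
      }
      where
      pairwiseCoprime : AllPairs Coprime (map ℤ.∣_∣ a)
      pairwiseCoprime = subst (AllPairs Coprime) (sym map-∣∣-a) ∣a∣-pairwiseCoprime

    a-nonzero : AllNonzero a
    a-nonzero i aᵢ≡0 =
      ≢-nonZero⁻¹ _ {{VecAll.lookup⁺ ∣a∣≢0 i}} (trans (lookup-map i ℤ.∣_∣ a) (cong ℤ.∣_∣ aᵢ≡0))
      where
      ∣a∣≢0 : VecAll.All NonZero (map ℤ.∣_∣ a)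
      ∣a∣≢0 = subst (VecAll.All NonZero) (sym map-∣∣-a) (_ ∷ _ ∷ _ ∷ _ ∷ n≢0 ∷ [])

    d : ℕ
    d = A * B * C

    ∣a∣-radDivides : VecAll.All (_RadDivides d) ∣a∣
    ∣a∣-radDivides =
      radDivides-^ 3 (∣⇒radDivides A∣d) ∷ radDivides-^ 3 (∣⇒radDivides B∣d) ∷
      radDivides-* (∣⇒radDivides 2∣d) (radDivides-^ 6 (radDivides-∣ rad[X]∣P P∣d)) ∷
      ∣⇒radDivides N+1∣d ∷ ∣⇒radDivides N-1∣d ∷ []
      where
      C∣d : C ∣ d
      C∣d = n∣m*n (A * B)
      A∣d : A ∣ d
      A∣d = ∣m⇒∣m*n C (m∣m*n B)
      B∣d : B ∣ d
      B∣d = ∣m⇒∣m*n C (n∣m*n A)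
      2∣d : 2 ∣ d
      2∣d = ∣-trans (∣m⇒∣m*n n (∣m⇒∣m*n (2 + n) (m∣m*n P))) C∣d
      P∣d : P ∣ d
      P∣d = ∣-trans (∣m⇒∣m*n n (∣m⇒∣m*n (2 + n) (n∣m*n 2))) C∣d
      N+1∣d : 2 + n ∣ d
      N+1∣d = ∣-trans (∣m⇒∣m*n n (n∣m*n (2 * P))) C∣d
      N-1∣d : n ∣ d
      N-1∣d = ∣-trans (n∣m*n (2 * P * (2 + n))) C∣d

    rad<X⁵ : rad ℤ.∣ prodℤ a ∣ < X ^ 5
    rad<X⁵ = begin-strict
      rad ℤ.∣ prodℤ a ∣ ≤⟨ ∣⇒≤ {{d≢0}} (rad∣ (radDivides-prodℤ ∣aᵢ∣-radDivides)) ⟩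
      A * B * C         ≤⟨ *-monoˡ-≤ C AB≤X⁴ ⟩
      X ^ 4 * C         <⟨ *-monoʳ-< (X ^ 4) C<X ⟩
      X ^ 4 * X         ≡⟨ *-comm (X ^ 4) X ⟩
      X ^ 5             ∎
      where
      open ≤-Reasoning
      d≢0 : NonZero d
      d≢0 = m*n≢0 (A * B) C {{_}} {{m*n≢0 (2 * P * (2 + n)) n}}
      ∣aᵢ∣-radDivides : VecAll.All (λ x → ℤ.∣ x ∣ RadDivides d) a
      ∣aᵢ∣-radDivides = VecAll.map⁻ (subst (VecAll.All (_RadDivides d)) (sym map-∣∣-a) ∣a∣-radDivides)

    X⁶≤maxAbs : X ^ 6 ≤ maxAbs a
    X⁶≤maxAbs = begin
      X ^ 6             ≤⟨ m≤n*m (X ^ 6) 2 ⟩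
      2 * X ^ 6         ≡⟨ 2+A³+B³≡2X⁶ ⟨
      2 + A ^ 3 + B ^ 3 ≤⟨ ∣lookup∣≤maxAbs a (suc (suc zero)) ⟩
      maxAbs a          ∎
      where open ≤-Reasoning

    a-quality : QualityAbove a 1 5
    a-quality = qualityAbove-6/5 a {X} rad<X⁵ X⁶≤maxAbs

    X≤maxAbs : X ≤ maxAbs a
    X≤maxAbs = ≤-trans X≤X⁶ X⁶≤maxAbs
      where
      X≤X⁶ : X ≤ X * X ^ 5
      X≤X⁶ = m≤m*n X (X ^ 5) {{m^n≢0 X 5}}

open import Data.Nat using (z≤n; s≤s; _+_; _*_; NonZero; >-nonZero)
open import Data.Nat.Properties using (≤-<-trans; <-≤-trans; m≤m*n; m≤n+m; m≤m+n)
open import Data.Nat.Divisibility using (∣n⇒∣m*n; ∣m⇒∣m*n; divides)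
open import Data.Nat.ListAction using (sum; product)
open import Data.Nat.ListAction.Properties using (∈⇒∣product; product≢0)
open import Data.List using (map)
import Data.List.Relation.Unary.All as All
open import Data.Product using (_,_)
open import Relation.Binary.PropositionalEquality using (refl)
open Quality using (maxAbs-∉)

largeQualityTuples : ∀ {F} N → All (3 ≤_) F → (∀ {f} → f ∈ F → f ∣ N) → 2 ∣ N → 6 < N →
  (S : List Tuple5) → ∃ λ a → InU F a × AllNonzero a × ¬ a ∈ S × QualityAbove a 1 5
largeQualityTuples (suc n) F≥3 F∣N 2∣N 6<N S =
  let w , M∣X-1 , rad[X]∣P , bound<X = arbitrarilyLargeX (sum (map maxAbs S) + C)
      open Witness w M∣X-1 rad[X]∣P (≤-<-trans (m≤n+m C (sum (map maxAbs S))) bound<X)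
  in a , a-inU F≥3 F∣N , a-nonzero ,
     maxAbs-∉ (<-≤-trans (≤-<-trans (m≤m+n (sum (map maxAbs S)) C) bound<X) X≤maxAbs) , a-quality
  where open Construction n 2∣N 6<N

theorem2p3 : (F : List ℕ) → ¬ (F ≡ []) → All (3 ≤_) F →
    Σ ℕ (λ r → Σ ℕ (λ s → 0 < r × 0 < s ×
      ((S : List Tuple5) →
        ∃ (λ a → InU F a × AllNonzero a × ¬ (a ∈ S) × QualityAbove a r s))))
theorem2p3 F _ F≥3 = 1 , 5 , s≤s z≤n , s≤s z≤n ,
  largeQualityTuples (8 * product F) F≥3 (λ f∈F → ∣n⇒∣m*n 8 (∈⇒∣product f∈F))
    (∣m⇒∣m*n (product F) (divides 4 refl)) (<-≤-trans 6<8 (m≤m*n 8 (product F) {{∏F≢0}}))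
  where
  ∏F≢0 : NonZero (product F)
  ∏F≢0 = product≢0 (All.map (λ 3≤f → >-nonZero (<-≤-trans (s≤s z≤n) 3≤f)) F≥3)
  6<8 : 6 < 8
  6<8 = s≤s (s≤s (s≤s (s≤s (s≤s (s≤s (s≤s z≤n))))))
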